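{- If $G$ is a connected graph of diameter two, then $\chi_\mu(G)\le \chi(G)$, where $\chi(G)$ is the (classical) chromatic number of $G$. Moreover, this bound is tight: for instance, for all positive integers $r,t$ with $(r,t)\neq(1,1)$, $\chi_\mu(K_{r,t})=2=\chi(K_{r,t})$.
   Context: All graphs are finite and simple. For a connected graph $G$ and $S\subseteq V(G)$, two vertices $x,y\in S$ are $S$-visible if there is a shortest $x,y$-path $P$ in $G$ with $V(P)\cap S=\{x,y\}$. $S$ is a mutual-visibility set if any two vertices of $S$ are $S$-visible. A mutual-visibility coloring of $G$ is a partition of $V(G)$ into mutual-visibility sets, and the mutual-visibility chromatic number $\chi_\mu(G)$ is the smallest number of classes in such a partition. -}

module Defs where

open import Data.Nat using (ℕ; zero; suc; _+_; _≤_; _<_)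
open import Data.Fin using (Fin; toℕ)
open import Data.List using (List; []; _∷_)
open import Data.List.Membership.Propositional using (_∈_)
open import Data.Product using (Σ; ∃; _×_; _,_)
open import Data.Sum using (_⊎_)
open import Relation.Nullary using (¬_)
open import Relation.Binary.PropositionalEquality using (_≡_; _≢_)

record Graph (n : ℕ) : Set₁ where
  field
    Adj   : Fin n → Fin n → Set
    sym   : ∀ {x y} → Adj x y → Adj y x
    irrefl : ∀ {x} → ¬ Adj x x

open Graph public

module _ {n : ℕ} (G : Graph n) where

  data Walk : Fin n → Fin n → Set where
    nil  : ∀ {x} → Walk x x
    cons : ∀ {x y z} → Adj G x y → Walk y z → Walk x z

  len : ∀ {x y} → Walk x y → ℕ
  len nil        = 0
  len (cons _ w) = suc (len w)

  verts : ∀ {x y} → Walk x y → List (Fin n)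
  verts {x} nil        = x ∷ []
  verts {x} (cons _ w) = x ∷ verts w

  -- a shortest x,y-path: an x,y-walk of minimum length
  -- (a minimum-length walk has no repeated vertices, so it is a path)
  IsShortest : ∀ {x y} → Walk x y → Set
  IsShortest {x} {y} w = (w' : Walk x y) → len w ≤ len w'

  Connected : Set
  Connected = (x y : Fin n) → Walk x y

  HasDist : Fin n → Fin n → ℕ → Set
  HasDist x y d = Σ (Walk x y) (λ w → len w ≡ d × IsShortest w)

  HasDiameter : ℕ → Set
  HasDiameter d =
    Connected ×
    ((x y : Fin n) → ∃ λ e → HasDist x y e × e ≤ d) ×
    (∃ λ x → ∃ λ y → HasDist x y d)

  Subset : Set₁
  Subset = Fin n → Set

  Visible : Subset → Fin n → Fin n → Set
  Visible S x y =
    Σ (Walk x y) λ P → IsShortest P ×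
      (∀ v → v ∈ verts P → S v → v ≡ x ⊎ v ≡ y)

  IsMutualVisibility : Subset → Set
  IsMutualVisibility S = ∀ x y → S x → S y → Visible S x y

  MVColoring : ℕ → Set
  MVColoring k = Σ (Fin n → Fin k) λ c →
    (i : Fin k) → IsMutualVisibility (λ v → c v ≡ i)

  ProperColoring : ℕ → Set
  ProperColoring k = Σ (Fin n → Fin k) λ c →
    ∀ x y → Adj G x y → c x ≢ c y

  IsChromaticNumber : ℕ → Set
  IsChromaticNumber k = ProperColoring k × (∀ j → ProperColoring j → k ≤ j)

  IsMVChromaticNumber : ℕ → Set
  IsMVChromaticNumber k = MVColoring k × (∀ j → MVColoring j → k ≤ j)

KAdj : (r t : ℕ) → Fin (r + t) → Fin (r + t) → Set
KAdj r t x y = (toℕ x < r × r ≤ toℕ y) ⊎ (r ≤ toℕ x × toℕ y < r)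

K : (r t : ℕ) → Graph (r + t)
K r t = record { Adj = KAdj r t ; sym = sy ; irrefl = ir }
  where
  open import Data.Sum using (inj₁; inj₂)
  open import Data.Nat.Properties using (<⇒≱)
  sy : ∀ {x y} → KAdj r t x y → KAdj r t y x
  sy (inj₁ (a , b)) = inj₂ (b , a)
  sy (inj₂ (a , b)) = inj₁ (b , a)
  ir : ∀ {x} → ¬ KAdj r t x x
  ir (inj₁ (a , b)) = <⇒≱ a b
  ir (inj₂ (a , b)) = <⇒≱ b a

-- A proper colour class is independent, and in a graph of diameter at most two
-- every shortest path between two of its vertices has at most one inner vertex,
-- which is adjacent to both ends and hence outside the class; so every proper
-- colouring is a mutual-visibility colouring. For K_{r,t} the two parts give both
-- colourings, and one class never suffices: an edge rules out one proper colour,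
-- and two non-adjacent vertices in a part of size at least two force an inner
-- vertex on every shortest path between them, which a single class would contain.
module Submission where

open import Defs hiding (sym)
open import Data.Nat using (ℕ; zero; suc; _+_; _≤_; _<_; z≤n; s≤s; _<?_)
open import Data.Nat.Properties using (<⇒≱; ≮⇒≥; m≤m+n)
open import Data.Fin using (Fin; toℕ; _↑ˡ_; _↑ʳ_) renaming (zero to fzero; suc to fsuc)
open import Data.Fin.Properties using (toℕ-↑ˡ; toℕ-↑ʳ; toℕ<n; ↑ˡ-injective; ↑ʳ-injective; 0≢1+n)
  renaming (_≟_ to _≟ᶠ_)
open import Data.List.Membership.Propositional using (_∈_)
open import Data.List.Relation.Unary.Any using (here; there)
open import Data.Product using (Σ; ∃; ∃₂; _×_; _,_)
open import Data.Sum using (_⊎_; inj₁; inj₂)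
open import Data.Empty using (⊥-elim)
open import Relation.Nullary using (¬_; yes; no)
open import Relation.Binary.PropositionalEquality
  using (_≡_; _≢_; refl; sym; trans; subst)

Fin1-≡0 : (i : Fin 1) → i ≡ fzero
Fin1-≡0 fzero = refl

module _ {n : ℕ} (G : Graph n) where

  Independent : Subset G → Set
  Independent S = ∀ {x y} → S x → S y → ¬ Adj G x y

  MeetsOnlyAtEnds : Subset G → ∀ {x y} → Walk G x y → Set
  MeetsOnlyAtEnds S {x} {y} w = ∀ v → v ∈ verts G w → S v → v ≡ x ⊎ v ≡ y

  DistAtMost : Fin n → Fin n → ℕ → Set
  DistAtMost x y d = Σ (Walk G x y) λ w → IsShortest G w × len G w ≤ d

  DiameterAtMost : ℕ → Set
  DiameterAtMost d = ∀ x y → DistAtMost x y d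

  hasDiameter⇒diameterAtMost : ∀ {d} → HasDiameter G d → DiameterAtMost d
  hasDiameter⇒diameterAtMost (_ , bounded , _) x y with bounded x y
  ... | e , (w , refl , shortest) , e≤d = w , shortest , e≤d

  nil-shortest : ∀ {x} → IsShortest G (nil {x = x})
  nil-shortest _ = z≤n

  edge-shortest : ∀ {x y} (xy : Adj G x y) → IsShortest G (cons xy nil)
  edge-shortest xy nil        = ⊥-elim (irrefl G xy)
  edge-shortest xy (cons _ _) = s≤s z≤n

  twoStep-shortest : ∀ {x y z} (xz : Adj G x z) (zy : Adj G z y) →
                     x ≢ y → ¬ Adj G x y → IsShortest G (cons xz (cons zy nil))
  twoStep-shortest xz zy x≢y _    nil                 = ⊥-elim (x≢y refl)
  twoStep-shortest xz zy _   ¬xy (cons xy nil)        = ⊥-elim (¬xy xy)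
  twoStep-shortest xz zy _   _   (cons _ (cons _ _)) = s≤s (s≤s z≤n)

  adjacent⇒distAtMost2 : ∀ {x y} → Adj G x y → DistAtMost x y 2
  adjacent⇒distAtMost2 xy = cons xy nil , edge-shortest xy , s≤s z≤n

  commonNeighbour⇒distAtMost2 : ∀ {x y z} → Adj G x z → Adj G z y → ¬ Adj G x y →
                                DistAtMost x y 2
  commonNeighbour⇒distAtMost2 {x} {y} xz zy ¬xy with x ≟ᶠ y
  ... | yes refl = nil , nil-shortest , z≤n
  ... | no x≢y   = cons xz (cons zy nil) , twoStep-shortest xz zy x≢y ¬xy , s≤s (s≤s z≤n)

  short-meetsOnlyAtEnds : ∀ {S x y} → Independent S → S x → S y →
                          (w : Walk G x y) → len G w ≤ 2 → MeetsOnlyAtEnds S w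
  short-meetsOnlyAtEnds _   _  _  nil                           _ _ (here refl) _ = inj₁ refl
  short-meetsOnlyAtEnds _   _  _  (cons _ nil)                  _ _ (here refl) _ = inj₁ refl
  short-meetsOnlyAtEnds _   _  _  (cons _ nil)                  _ _ (there (here refl)) _ = inj₂ refl
  short-meetsOnlyAtEnds _   _  _  (cons _ (cons _ nil))         _ _ (here refl) _ = inj₁ refl
  short-meetsOnlyAtEnds ind Sx _  (cons xz (cons _ nil))        _ _ (there (here refl)) Sz =
    ⊥-elim (ind Sx Sz xz)
  short-meetsOnlyAtEnds _   _  _  (cons _ (cons _ nil))         _ _ (there (there (here refl))) _ =
    inj₂ refl
  short-meetsOnlyAtEnds _   _  _  (cons _ (cons _ (cons _ _))) (s≤s (s≤s ()))

  independent⇒mutualVisibility : DiameterAtMost 2 → ∀ {S} → Independent S →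
                                 IsMutualVisibility G S
  independent⇒mutualVisibility diam ind x y Sx Sy with diam x y
  ... | w , shortest , len≤2 = w , shortest , short-meetsOnlyAtEnds ind Sx Sy w len≤2

  properColoring-class-independent : ∀ {k} ((c , _) : ProperColoring G k) (i : Fin k) →
                                     Independent (λ v → c v ≡ i)
  properColoring-class-independent (c , proper) i {x} {y} cx cy xy =
    proper x y xy (trans cx (sym cy))

  properColoring⇒mvColoring : DiameterAtMost 2 → ∀ {k} → ProperColoring G k → MVColoring G k
  properColoring⇒mvColoring diam col@(c , _) =
    c , λ i → independent⇒mutualVisibility diam (properColoring-class-independent col i)

  mutualVisibility-nonadjacent⇒nonspanning : ∀ {S x y} → IsMutualVisibility G S →
    S x → S y → x ≢ y → ¬ Adj G x y → ∃ λ v → ¬ S v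
  mutualVisibility-nonadjacent⇒nonspanning {S} {x} {y} mv Sx Sy x≢y ¬xy
    with mv x y Sx Sy
  ... | nil , _ = ⊥-elim (x≢y refl)
  ... | cons xy nil , _ = ⊥-elim (¬xy xy)
  ... | cons {y = z} xz (cons _ _) , _ , meets = z , inner∉S
    where
    inner∉S : ¬ S z
    inner∉S Sz with meets z (there (here refl)) Sz
    ... | inj₁ refl = irrefl G xz
    ... | inj₂ refl = ¬xy xz

  properColoring-edge⇒2≤ : ∀ {x y} → Adj G x y → ∀ {j} → ProperColoring G j → 2 ≤ j
  properColoring-edge⇒2≤ {x} _  {zero}        (c , _) with c x
  ... | ()
  properColoring-edge⇒2≤ {x} {y} xy {suc zero} (c , proper) with c x | c y | proper x y xy
  ... | fzero | fzero | cx≢cy = ⊥-elim (cx≢cy refl)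
  properColoring-edge⇒2≤ _  {suc (suc _)} _ = s≤s (s≤s z≤n)

  mvColoring-nonadjacent⇒2≤ : ∀ {x y} → x ≢ y → ¬ Adj G x y → ∀ {j} → MVColoring G j → 2 ≤ j
  mvColoring-nonadjacent⇒2≤ {x} _ _ {zero} (c , _) with c x
  ... | ()
  mvColoring-nonadjacent⇒2≤ {x} {y} x≢y ¬xy {suc zero} (c , mv)
    with mutualVisibility-nonadjacent⇒nonspanning (mv fzero) (Fin1-≡0 (c x)) (Fin1-≡0 (c y)) x≢y ¬xy
  ... | v , cv≢0 = ⊥-elim (cv≢0 (Fin1-≡0 (c v)))
  mvColoring-nonadjacent⇒2≤ _ _ {suc (suc _)} _ = s≤s (s≤s z≤n)

module _ {r t : ℕ} where

  left : Fin r → Fin (r + t)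
  left i = i ↑ˡ t

  right : Fin t → Fin (r + t)
  right j = r ↑ʳ j

  left-< : ∀ i → toℕ (left i) < r
  left-< i = subst (_< r) (sym (toℕ-↑ˡ i t)) (toℕ<n i)

  right-≥ : ∀ j → r ≤ toℕ (right j)
  right-≥ j = subst (r ≤_) (sym (toℕ-↑ʳ r j)) (m≤m+n r (toℕ j))

  left-nonadjacent : ∀ {x y} → toℕ x < r → toℕ y < r → ¬ KAdj r t x y
  left-nonadjacent _   y<r (inj₁ (_ , r≤y)) = <⇒≱ y<r r≤y
  left-nonadjacent x<r _   (inj₂ (r≤x , _)) = <⇒≱ x<r r≤x

  right-nonadjacent : ∀ {x y} → r ≤ toℕ x → r ≤ toℕ y → ¬ KAdj r t x y
  right-nonadjacent r≤x _   (inj₁ (x<r , _)) = <⇒≱ x<r r≤x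
  right-nonadjacent _   r≤y (inj₂ (_ , y<r)) = <⇒≱ y<r r≤y

  side : Fin (r + t) → Fin 2
  side v with toℕ v <? r
  ... | yes _ = fzero
  ... | no _  = fsuc fzero

  side-left : ∀ {v} → toℕ v < r → side v ≡ fzero
  side-left {v} v<r with toℕ v <? r
  ... | yes _  = refl
  ... | no v≮r = ⊥-elim (v≮r v<r)

  side-right : ∀ {v} → r ≤ toℕ v → side v ≡ fsuc fzero
  side-right {v} r≤v with toℕ v <? r
  ... | yes v<r = ⊥-elim (<⇒≱ v<r r≤v)
  ... | no _    = refl

  K-sideColoring : ProperColoring (K r t) 2
  K-sideColoring = side , proper
    where
    proper : ∀ x y → KAdj r t x y → side x ≢ side y
    proper x y (inj₁ (x<r , r≤y)) rewrite side-left x<r | side-right r≤y = λ ()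
    proper x y (inj₂ (r≤x , y<r)) rewrite side-right r≤x | side-left y<r = λ ()

  K-edge : 1 ≤ r → 1 ≤ t → ∃₂ λ x y → KAdj r t x y
  K-edge (s≤s _) (s≤s _) = left fzero , right fzero , inj₁ (left-< fzero , right-≥ fzero)

  left-pair : 2 ≤ r → ∃₂ λ x y → x ≢ y × ¬ KAdj r t x y
  left-pair (s≤s (s≤s _)) =
    left fzero , left (fsuc fzero) , (λ eq → 0≢1+n (↑ˡ-injective t _ _ eq)) ,
    left-nonadjacent (left-< fzero) (left-< (fsuc fzero))

  right-pair : 2 ≤ t → ∃₂ λ x y → x ≢ y × ¬ KAdj r t x y
  right-pair (s≤s (s≤s _)) =
    right fzero , right (fsuc fzero) , (λ eq → 0≢1+n (↑ʳ-injective r _ _ eq)) ,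
    right-nonadjacent (right-≥ fzero) (right-≥ (fsuc fzero))

  K-diameterAtMost2 : 1 ≤ r → 1 ≤ t → DiameterAtMost (K r t) 2
  K-diameterAtMost2 (s≤s _) (s≤s _) x y with toℕ x <? r | toℕ y <? r
  ... | yes x<r | yes y<r = commonNeighbour⇒distAtMost2 (K r t)
    (inj₁ (x<r , right-≥ fzero)) (inj₂ (right-≥ fzero , y<r)) (left-nonadjacent x<r y<r)
  ... | no x≮r  | no y≮r  = commonNeighbour⇒distAtMost2 (K r t)
    (inj₂ (≮⇒≥ x≮r , left-< fzero)) (inj₁ (left-< fzero , ≮⇒≥ y≮r))
    (right-nonadjacent (≮⇒≥ x≮r) (≮⇒≥ y≮r))
  ... | yes x<r | no y≮r  = adjacent⇒distAtMost2 (K r t) (inj₁ (x<r , ≮⇒≥ y≮r))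
  ... | no x≮r  | yes y<r = adjacent⇒distAtMost2 (K r t) (inj₂ (≮⇒≥ x≮r , y<r))

K-nonadjacentPair : ∀ {r t} → 1 ≤ r → 1 ≤ t → ¬ (r ≡ 1 × t ≡ 1) →
                    ∃₂ λ x y → x ≢ y × ¬ KAdj r t x y
K-nonadjacentPair {r@(suc (suc _))} {t}               _ _ _ = left-pair {r} {t} (s≤s (s≤s z≤n))
K-nonadjacentPair {suc zero}        {t@(suc (suc _))} _ _ _ = right-pair {1} {t} (s≤s (s≤s z≤n))
K-nonadjacentPair {suc zero}        {suc zero}        _ _ ¬K₁₁ = ⊥-elim (¬K₁₁ (refl , refl))

mvChromatic≤chromatic : ∀ {n} (G : Graph n) → DiameterAtMost G 2 →
                        ∀ {a b} → IsMVChromaticNumber G a → IsChromaticNumber G b → a ≤ b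
mvChromatic≤chromatic G diam {b = b} (_ , a-minimal) (χ-coloring , _) =
  a-minimal b (properColoring⇒mvColoring G diam χ-coloring)

K-mvChromatic≡2 : ∀ {r t} → 1 ≤ r → 1 ≤ t → ¬ (r ≡ 1 × t ≡ 1) → IsMVChromaticNumber (K r t) 2
K-mvChromatic≡2 {r} {t} 1≤r 1≤t ¬K₁₁ with K-nonadjacentPair 1≤r 1≤t ¬K₁₁
... | _ , _ , x≢y , ¬xy =
  properColoring⇒mvColoring (K r t) (K-diameterAtMost2 1≤r 1≤t) K-sideColoring ,
  λ _ → mvColoring-nonadjacent⇒2≤ (K r t) x≢y ¬xy

K-chromatic≡2 : ∀ {r t} → 1 ≤ r → 1 ≤ t → IsChromaticNumber (K r t) 2
K-chromatic≡2 {r} {t} 1≤r 1≤t with K-edge 1≤r 1≤t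
... | _ , _ , xy = K-sideColoring , λ _ → properColoring-edge⇒2≤ (K r t) xy

proposition2p2 :
    ((n : ℕ) (G : Graph n) → Connected G → HasDiameter G 2 →
      (a b : ℕ) → IsMVChromaticNumber G a → IsChromaticNumber G b → a ≤ b)
    ×
    ((r t : ℕ) → 1 ≤ r → 1 ≤ t → ¬ (r ≡ 1 × t ≡ 1) →
      IsMVChromaticNumber (K r t) 2 × IsChromaticNumber (K r t) 2)
proposition2p2 =
  (λ _ G _ diam _ _ → mvChromatic≤chromatic G (hasDiameter⇒diameterAtMost G diam)) ,
  (λ _ _ 1≤r 1≤t ¬K₁₁ → K-mvChromatic≡2 1≤r 1≤t ¬K₁₁ , K-chromatic≡2 1≤r 1≤t)
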